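{- Let $X$ be a discrete generalized ordered set and $Y$ any generalized ordered set. Then $X\times Y$ with the weak lexicographic order $<_w$ is a generalized ordered set.
   Context: The setting is constructive mathematics: no use of the law of excluded middle. For a set with a binary relation $<$, write $x\leq_{P}y$ if for all $z$, $z<x$ implies $z<y$, and $y<z$ implies $x<z$. A generalized ordered set is a set with a binary relation $<$ that is asymmetric ($x<y$ implies $\neg(y<x)$), transitive ($x<y<z$ implies $x<z$) and positively antisymmetric ($x\leq_{P}y$ and $y\leq_{P}x$ imply $x=y$). $X$ is discrete if for all $x,y\in X$, $x<y$ or $x=y$ or $y<x$. The product $X\times Y$ has componentwise equality. The weak lexicographic order is: $(x,y)<_w(x',y')$ iff (1) $x\leq_{P}x'$ in $X$; (2) $x=x'$ implies $y<y'$; and (3) $\neg(x=x')$ implies $x<x'$. -}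

module Defs where

open import Level using (Level; _⊔_)
open import Data.Product using (_×_; _,_)
open import Data.Sum using (_⊎_)
open import Relation.Nullary using (¬_)
open import Relation.Binary.PropositionalEquality using (_≡_)

_≤P[_]_ : ∀ {a ℓ} {A : Set a} → A → (A → A → Set ℓ) → A → Set (a ⊔ ℓ)
x ≤P[ _<_ ] y = ∀ z → (z < x → z < y) × (y < z → x < z)

record IsGenOrd {a ℓ} (A : Set a) (_<_ : A → A → Set ℓ) : Set (a ⊔ ℓ) where
  field
    asym  : ∀ {x y} → x < y → ¬ (y < x)
    trans : ∀ {x y z} → x < y → y < z → x < z
    posAntisym : ∀ {x y} → x ≤P[ _<_ ] y → y ≤P[ _<_ ] x → x ≡ y

Discrete : ∀ {a ℓ} {A : Set a} → (A → A → Set ℓ) → Set (a ⊔ ℓ)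
Discrete {A = A} _<_ = ∀ (x y : A) → (x < y) ⊎ (x ≡ y) ⊎ (y < x)

weakLex : ∀ {a b ℓ m} {X : Set a} {Y : Set b} →
          (X → X → Set ℓ) → (Y → Y → Set m) → X × Y → X × Y → Set (a ⊔ ℓ ⊔ m)
weakLex _<X_ _<Y_ (x , y) (x' , y') =
  (x ≤P[ _<X_ ] x') × ((x ≡ x' → y <Y y') × (¬ (x ≡ x') → x <X x'))

-- Antisymmetry of ≤P on X forces the first components of two mutually comparable pairs to coincide,
-- which reduces asymmetry, transitivity and the equal-first-component cases to the order on Y.
-- Discreteness of X is what makes condition (3) automatic: x ≤P x' with x ≢ x' already gives x < x'.
module Submission where

open import Defs
open import Level using (_⊔_)
open import Data.Product using (_×_; _,_; proj₁; proj₂)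
open import Data.Sum using (inj₁; inj₂)
open import Data.Empty using (⊥-elim)
open import Function using (id)
open import Relation.Nullary using (¬_)
open import Relation.Binary.Core using (Rel)
open import Relation.Binary.Definitions using (Asymmetric; Transitive)
open import Relation.Binary.PropositionalEquality using (_≡_; refl)

module _ {a ℓ} {A : Set a} {_<_ : Rel A ℓ} where

  ≤P-refl : ∀ {x} → x ≤P[ _<_ ] x
  ≤P-refl z = id , id

  ≤P-trans : ∀ {x y z} → x ≤P[ _<_ ] y → y ≤P[ _<_ ] z → x ≤P[ _<_ ] z
  ≤P-trans x≤y y≤z w = (λ w<x → proj₁ (y≤z w) (proj₁ (x≤y w) w<x))
                     , (λ z<w → proj₂ (x≤y w) (proj₂ (y≤z w) z<w))

  <⇒≤P : Transitive _<_ → ∀ {x y} → x < y → x ≤P[ _<_ ] y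
  <⇒≤P trans x<y z = (λ z<x → trans z<x x<y) , (λ y<z → trans x<y y<z)

  ≤P∧≢⇒< : Asymmetric _<_ → Discrete _<_ → ∀ {x y} → x ≤P[ _<_ ] y → ¬ (x ≡ y) → x < y
  ≤P∧≢⇒< asym discrete {x} {y} x≤y x≢y with discrete x y
  ... | inj₁ x<y        = x<y
  ... | inj₂ (inj₁ x≡y) = ⊥-elim (x≢y x≡y)
  ... | inj₂ (inj₂ y<x) = let y<y = proj₁ (x≤y y) y<x in ⊥-elim (asym y<y y<y)

module _ {a b ℓ m} {X : Set a} {Y : Set b} {_<X_ : Rel X ℓ} {_<Y_ : Rel Y m} where

  private
    _<W_ : Rel (X × Y) (a ⊔ ℓ ⊔ m)
    _<W_ = weakLex _<X_ _<Y_

  <Y⇒<W : ∀ {x y y'} → y <Y y' → (x , y) <W (x , y')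
  <Y⇒<W y<y' = ≤P-refl {_<_ = _<X_} , (λ _ → y<y') , (λ x≢x → ⊥-elim (x≢x refl))

  <X⇒<W : IsGenOrd X _<X_ → ∀ {x x' y y'} → x <X x' → (x , y) <W (x' , y')
  <X⇒<W GX {x} x<x' = <⇒≤P trans x<x'
                    , (λ { refl → ⊥-elim (asym x<x' x<x') })
                    , (λ _ → x<x')
    where open IsGenOrd GX

  <W-asym : IsGenOrd X _<X_ → IsGenOrd Y _<Y_ → Asymmetric _<W_
  <W-asym GX GY (x≤x' , y<y' , _) (x'≤x , y'<y , _)
    with IsGenOrd.posAntisym GX x≤x' x'≤x
  ... | refl = IsGenOrd.asym GY (y<y' refl) (y'<y refl)

  <W-trans : IsGenOrd X _<X_ → Discrete _<X_ → IsGenOrd Y _<Y_ → Transitive _<W_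
  <W-trans GX discrete GY {x , y} {x' , y'} {x'' , y''}
           (x≤x' , y<y' , _) (x'≤x'' , y'<y'' , _) =
    x≤x'' , equal-case , ≤P∧≢⇒< asym discrete x≤x''
    where
    open IsGenOrd GX
    x≤x'' : x ≤P[ _<X_ ] x''
    x≤x'' = ≤P-trans {_<_ = _<X_} x≤x' x'≤x''
    equal-case : x ≡ x'' → y <Y y''
    equal-case refl with posAntisym x≤x' x'≤x''
    ... | refl = IsGenOrd.trans GY (y<y' refl) (y'<y'' refl)

  <W-irrefl : IsGenOrd X _<X_ → IsGenOrd Y _<Y_ → ∀ {u} → ¬ (u <W u)
  <W-irrefl GX GY u<u = <W-asym GX GY u<u u<u

  ≤PW⇒≤PY : ∀ {x y y'} → (x , y) ≤P[ _<W_ ] (x , y') → y ≤P[ _<Y_ ] y'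
  ≤PW⇒≤PY {x} P z = (λ z<y → proj₁ (proj₂ (proj₁ (P (x , z)) (<Y⇒<W z<y))) refl)
                  , (λ y'<z → proj₁ (proj₂ (proj₂ (P (x , z)) (<Y⇒<W y'<z))) refl)

  ≤PW-antisym : IsGenOrd X _<X_ → Discrete _<X_ → IsGenOrd Y _<Y_ →
                ∀ {u v} → u ≤P[ _<W_ ] v → v ≤P[ _<W_ ] u → u ≡ v
  ≤PW-antisym GX discrete GY {x , y} {x' , y'} P Q with discrete x x'
  ... | inj₁ x<x' = ⊥-elim (<W-irrefl GX GY (proj₁ (Q (x , y)) (<X⇒<W GX x<x')))
  ... | inj₂ (inj₂ x'<x) = ⊥-elim (<W-irrefl GX GY (proj₁ (P (x' , y')) (<X⇒<W GX x'<x)))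
  ... | inj₂ (inj₁ refl)
    with IsGenOrd.posAntisym GY (≤PW⇒≤PY P) (≤PW⇒≤PY Q)
  ... | refl = refl

theorem27 : ∀ {a b ℓ m} {X : Set a} {Y : Set b}
    (_<X_ : X → X → Set ℓ) (_<Y_ : Y → Y → Set m) →
    IsGenOrd X _<X_ → Discrete _<X_ → IsGenOrd Y _<Y_ →
    IsGenOrd (X × Y) (weakLex _<X_ _<Y_)
theorem27 _<X_ _<Y_ GX discrete GY = record
  { asym       = <W-asym GX GY
  ; trans      = <W-trans GX discrete GY
  ; posAntisym = ≤PW-antisym GX discrete GY
  }
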